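{- Let $a,b$ be positive integers and let $K_3(a,b)=\langle a,a,b\rangle$ and $K_4(a,b)$ be the lattice with Gram matrix $\begin{pmatrix}2a&0&-a\\0&2a&-a\\-a&-a&b\end{pmatrix}$, assumed primitive (and positive definite). Then the isometry groups of $K_3(a,b)$ and $K_4(a,b)$ have order $16$, except for $K_3(1,1)$, $K_4(1,2)$ and $K_4(2,3)$.
   Context: Lattices are $\mathbb{Z}$-lattices on positive definite quadratic spaces over $\mathbb{Q}$; primitive means the scale ideal (generated by all values of the bilinear form) is $\mathbb{Z}$; $\langle a_1,a_2,a_3\rangle$ is the diagonal Gram matrix; $O(K)$ is the isometry group. -}

module Defs where

open import Data.Nat using (ℕ; zero; suc)
open import Data.Nat.Divisibility using (_∣_)
open import Data.Integer using (ℤ; +_; -_; _+_; _*_; _<_; ∣_∣)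
open import Data.Fin using (Fin)
open import Data.Vec using (Vec; []; _∷_; lookup; tabulate; transpose; replicate)
open import Data.List using (List; length)
open import Data.List.Membership.Propositional using (_∈_)
open import Data.List.Relation.Unary.Unique.Propositional using (Unique)
open import Data.Product using (Σ; _×_)
open import Function.Bundles using (_⇔_)
open import Relation.Binary.PropositionalEquality using (_≡_)
open import Relation.Nullary using (¬_)

-- Square integer matrices, as vectors of rows (so _≡_ is structural equality).
Mat : ℕ → Set
Mat n = Vec (Vec ℤ n) n

entry : ∀ {n} → Mat n → Fin n → Fin n → ℤ
entry M i j = lookup (lookup M i) j

sumℤ : ∀ {n} → Vec ℤ n → ℤ
sumℤ [] = + 0
sumℤ (x ∷ xs) = x + sumℤ xs

_⊗_ : ∀ {n} → Mat n → Mat n → Mat n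
A ⊗ B = tabulate λ i → tabulate λ j → sumℤ (tabulate λ k → entry A i k * entry B k j)

identity : ∀ {n} → Mat n
identity = tabulate λ i → tabulate λ j → δ i j
  where
  δ : ∀ {n} → Fin n → Fin n → ℤ
  δ Fin.zero Fin.zero = + 1
  δ (Fin.suc i) (Fin.suc j) = δ i j
  δ _ _ = + 0

qform : ∀ {n} → Mat n → Vec ℤ n → ℤ
qform G v = sumℤ (tabulate λ i → sumℤ (tabulate λ j → lookup v i * entry G i j * lookup v j))

-- Positive definite Gram matrix: Q(v) > 0 for every nonzero integer vector v
-- (equivalent to positivity over ℚ by clearing denominators).
PositiveDefinite : ∀ {n} → Mat n → Set
PositiveDefinite {n} G = (v : Vec ℤ n) → ¬ (v ≡ replicate n (+ 0)) → + 0 < qform G v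

-- Primitive: the scale ideal (generated by all entries of the Gram matrix) is ℤ,
-- i.e. the only natural number dividing every entry is 1.
Primitive : ∀ {n} → Mat n → Set
Primitive G = (d : ℕ) → (∀ i j → d ∣ ∣ entry G i j ∣) → d ≡ 1

IsIsometry : ∀ {n} → Mat n → Mat n → Set
IsIsometry {n} G g = (Σ (Mat n) λ h → (g ⊗ h ≡ identity) × (h ⊗ g ≡ identity))
                   × (transpose g ⊗ (G ⊗ g) ≡ G)

HasCardinality : {A : Set} → (A → Set) → ℕ → Set
HasCardinality {A} P k =
  Σ (List A) λ xs → (length xs ≡ k) × Unique xs × (∀ x → P x ⇔ x ∈ xs)

IsometryGroupOrder : ∀ {n} → Mat n → ℕ → Set
IsometryGroupOrder G k = HasCardinality (IsIsometry G) k

K₃ : ℕ → ℕ → Mat 3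
K₃ a b = ( + a ∷ + 0 ∷ + 0 ∷ [])
       ∷ ( + 0 ∷ + a ∷ + 0 ∷ [])
       ∷ ( + 0 ∷ + 0 ∷ + b ∷ [])
       ∷ []

K₄ : ℕ → ℕ → Mat 3
K₄ a b = ( + 2 * + a ∷ + 0 ∷ - + a ∷ [])
       ∷ ( + 0 ∷ + 2 * + a ∷ - + a ∷ [])
       ∷ ( - + a ∷ - + a ∷ + b ∷ [])
       ∷ []

-- Both lattices split as
-- K = a·E + b·⟨0,0,1⟩, with E = ⟨1,1,0⟩ for K₃ and E = K₄(1,0) for K₄, and the heart of the
-- proof is that g also preserves the summand ⟨0,0,1⟩, i.e. that its third row is (0,0,±1).
-- Cancelling a, g then preserves E too, and the integral matrices preserving both summands
-- are enumerated directly: there are 16 of them in each case.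
--
-- For K₃ (where a ≠ b by primitivity) this is a comparison of norms. If a < b the first two
-- columns have norm a < b, so their third coordinates vanish, and invertibility makes the
-- corner entry a unit. If b < a the third column has norm b < a, so it is ±e₃, and
-- orthogonality to it kills the third coordinates of the other two columns.
--
-- For K₄ positive definiteness gives b = a + c with c > 0. With h = g⁻¹, expanding
-- e₃ = g (h e₃) in B(u, e₃) = b u₂ − a(u₀ + u₁) gives b u₂ = a(u₀ + u₁ + 2h₀₂ − h₂₂) for the
-- first column u, so a ∣ u₂ since a and b are coprime. Writing u₂ = t a, the norm identity
-- 2Q(u) = a((2u₀ − u₂)² + (2u₁ − u₂)²) + 2c u₂² = 4a leaves t ≠ 0 only for (a,c) = (1,1) or
-- (2,1), the excluded K₄(1,2) and K₄(2,3), and for a = t = 1, c = 2, which fails by parity.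
-- The second column is handled in the same way.

module Submission where

open import Defs
open import Data.Nat using (ℕ; _>_)
open import Data.Product using (_×_)
open import Relation.Binary.PropositionalEquality using (_≡_)
open import Relation.Nullary using (¬_)

open import Data.Nat as ℕ using (zero; suc; s≤s)
import Data.Nat.Properties as ℕ
import Data.Nat.Tactic.RingSolver as ℕ-Solver
open import Data.Nat.Divisibility using (_∣_; divides; ∣-refl)
open import Data.Nat.Coprimality using (Coprime; coprime-divisor)
open import Data.Integer
  using (ℤ; +_; +0; +[1+_]; -[1+_]; _+_; _*_; -_; _-_; _⊖_; _<_; ∣_∣; 0ℤ; 1ℤ; -1ℤ; NonZero; _≟_)
import Data.Integer.Properties as ℤ
import Data.Integer.Divisibility.Signed as ℤ
open import Data.Integer.Tactic.RingSolver using (solve-∀; solve)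
open import Data.Fin as Fin using (Fin)
open import Data.Fin.Properties using (all?)
open import Data.Vec as Vec using (Vec; []; _∷_; lookup; tabulate; transpose; replicate; _⊛_; toList)
open import Data.Vec.Properties
  using (lookup∘tabulate; tabulate∘lookup; tabulate-cong; lookup-⊛; lookup-replicate; ≡-dec)
open import Data.Product using (_,_; proj₁; proj₂; ∃)
open import Data.Sum using ([_,_]′)
open import Data.List using (List; []; _∷_)
open import Data.List.Membership.Propositional using (_∈_)
import Data.List.Membership.DecPropositional as DecMembership
open import Data.List.Relation.Unary.All as All using (All)
open import Data.List.Relation.Unary.Any as Any using (Any; here; there)
open import Data.List.Relation.Unary.Unique.Propositional using (Unique)
open import Data.List.Relation.Unary.Unique.DecPropositional using (unique?)
open import Algebra.Bundles using (AbelianGroup)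
open import Algebra.Properties.CommutativeSemigroup ℤ.+-commutativeSemigroup using (interchange)
open import Algebra.Properties.Group (AbelianGroup.group ℤ.+-0-abelianGroup) using (∙-cancelʳ)
open import Function using (id; _∘_)
open import Function.Bundles using (_⇔_; mk⇔; Equivalence)
open import Relation.Binary.Definitions using (DecidableEquality; Tri; tri<; tri≈; tri>)
open import Relation.Binary.PropositionalEquality
  using (_≢_; refl; sym; trans; cong; cong₂; subst; module ≡-Reasoning)
open import Relation.Nullary using (Dec; yes; no; contradiction)
open import Relation.Nullary.Decidable using (toWitness; _×-dec_; _→-dec_)

open ≡-Reasoning

private variable
  n : ℕ

-- Gram forms of integer matrices

column : Mat n → Fin n → Vec ℤ n
column g = lookup (transpose g)

form : Mat n → Vec ℤ n → Vec ℤ n → ℤ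
form G x y = sumℤ (tabulate λ i → lookup x i * sumℤ (tabulate λ j → entry G i j * lookup y j))

Preserves : Mat n → Mat n → Set
Preserves G g = ∀ i j → form G (column g i) (column g j) ≡ entry G i j

record LinearCombination (G : Mat n) (A : ℤ) (E : Mat n) (B : ℤ) (F : Mat n) : Set where
  constructor entrywise
  field entry-≡ : ∀ i j → entry G i j ≡ A * entry E i j + B * entry F i j

sumℤ-+ : (f g : Fin n → ℤ) → sumℤ (tabulate λ i → f i + g i) ≡ sumℤ (tabulate f) + sumℤ (tabulate g)
sumℤ-+ {zero}  f g = refl
sumℤ-+ {suc n} f g = trans (cong (_+_ (f Fin.zero + g Fin.zero)) (sumℤ-+ (f ∘ Fin.suc) (g ∘ Fin.suc)))
  (interchange (f Fin.zero) (g Fin.zero) _ _)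

sumℤ-* : ∀ c (f : Fin n → ℤ) → sumℤ (tabulate λ i → c * f i) ≡ c * sumℤ (tabulate f)
sumℤ-* {zero}  c f = sym (ℤ.*-zeroʳ c)
sumℤ-* {suc n} c f = trans (cong (_+_ (c * f Fin.zero)) (sumℤ-* c (f ∘ Fin.suc))) (sym (ℤ.*-distribˡ-+ c _ _))

sumℤ-linear : ∀ A B (f g : Fin n → ℤ) →
  sumℤ (tabulate λ i → A * f i + B * g i) ≡ A * sumℤ (tabulate f) + B * sumℤ (tabulate g)
sumℤ-linear A B f g = trans (sumℤ-+ (λ i → A * f i) (λ i → B * g i)) (cong₂ _+_ (sumℤ-* A f) (sumℤ-* B g))

form-linear : ∀ {G A E B F} → LinearCombination {n} G A E B F →
  ∀ x y → form G x y ≡ A * form E x y + B * form F x y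
form-linear {G = G} {A} {E} {B} {F} (entrywise comb) x y = begin
  form G x y
    ≡⟨ cong sumℤ (tabulate-cong λ i → cong (lookup x i *_) (row i)) ⟩
  sumℤ (tabulate λ i → lookup x i * (A * rowE i + B * rowF i))
    ≡⟨ cong sumℤ (tabulate-cong λ i → distribute (lookup x i) A (rowE i) B (rowF i)) ⟩
  sumℤ (tabulate λ i → A * (lookup x i * rowE i) + B * (lookup x i * rowF i))
    ≡⟨ sumℤ-linear A B (λ i → lookup x i * rowE i) (λ i → lookup x i * rowF i) ⟩
  A * form E x y + B * form F x y ∎
  where
  rowE rowF : Fin _ → ℤ
  rowE i = sumℤ (tabulate λ j → entry E i j * lookup y j)
  rowF i = sumℤ (tabulate λ j → entry F i j * lookup y j)
  distribute : ∀ x A s B t → x * (A * s + B * t) ≡ A * (x * s) + B * (x * t)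
  distribute = solve-∀
  distributeʳ : ∀ A e B f y → (A * e + B * f) * y ≡ A * (e * y) + B * (f * y)
  distributeʳ = solve-∀
  row : ∀ i → sumℤ (tabulate λ j → entry G i j * lookup y j) ≡ A * rowE i + B * rowF i
  row i = trans (cong sumℤ (tabulate-cong λ j → trans (cong (_* lookup y j) (comb i j)) (distributeʳ A _ B _ _)))
                (sumℤ-linear A B (λ j → entry E i j * lookup y j) (λ j → entry F i j * lookup y j))

qform≡form : ∀ (G : Mat n) x → qform G x ≡ form G x x
qform≡form G x = cong sumℤ (tabulate-cong λ i →
  trans (cong sumℤ (tabulate-cong λ j → ℤ.*-assoc (lookup x i) (entry G i j) (lookup x j)))
        (sumℤ-* (lookup x i) (λ j → entry G i j * lookup x j)))

entry-tabulate : ∀ (f : Fin n → Fin n → ℤ) i j → entry (tabulate λ i → tabulate (f i)) i j ≡ f i j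
entry-tabulate f i j = trans (cong (λ r → lookup r j) (lookup∘tabulate _ i)) (lookup∘tabulate (f i) j)

lookup-transpose-∷ : ∀ {m} {A : Set} (r : Vec A n) (g : Vec (Vec A n) m) i →
  lookup (transpose (r ∷ g)) i ≡ lookup r i ∷ lookup (transpose g) i
lookup-transpose-∷ {n} r g i = begin
  lookup ((replicate n Vec._∷_ ⊛ r) ⊛ transpose g) i           ≡⟨ lookup-⊛ i (replicate n Vec._∷_ ⊛ r) (transpose g) ⟩
  lookup (replicate n Vec._∷_ ⊛ r) i (lookup (transpose g) i)
    ≡⟨ cong (λ h → h (lookup (transpose g) i)) (lookup-⊛ i (replicate n Vec._∷_) r) ⟩
  lookup (replicate n Vec._∷_) i (lookup r i) (lookup (transpose g) i)
    ≡⟨ cong (λ h → h (lookup r i) (lookup (transpose g) i)) (lookup-replicate i Vec._∷_) ⟩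
  lookup r i ∷ lookup (transpose g) i ∎

lookup-transpose : ∀ {m} {A : Set} (g : Vec (Vec A n) m) i k → lookup (lookup (transpose g) i) k ≡ lookup (lookup g k) i
lookup-transpose (r ∷ g) i k with lookup-transpose-∷ r g i
lookup-transpose (r ∷ g) i Fin.zero    | eq = cong (λ c → lookup c Fin.zero) eq
lookup-transpose (r ∷ g) i (Fin.suc k) | eq = trans (cong (λ c → lookup c (Fin.suc k)) eq) (lookup-transpose g i k)

matrix-ext : ∀ {A B : Mat n} → (∀ i j → entry A i j ≡ entry B i j) → A ≡ B
matrix-ext {A = A} {B} eq = trans (sym (tabulate∘lookup A))
  (trans (tabulate-cong λ i → vector-ext (eq i)) (tabulate∘lookup B))
  where
  vector-ext : ∀ {r s : Vec ℤ n} → (∀ j → lookup r j ≡ lookup s j) → r ≡ s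
  vector-ext {r = r} {s} p = trans (sym (tabulate∘lookup r)) (trans (tabulate-cong p) (tabulate∘lookup s))

entry-⊗ : ∀ (A B : Mat n) i j → entry (A ⊗ B) i j ≡ sumℤ (tabulate λ k → entry A i k * entry B k j)
entry-⊗ A B = entry-tabulate (λ i j → sumℤ (tabulate λ k → entry A i k * entry B k j))

gram-entry : ∀ (G g : Mat n) i j → entry (transpose g ⊗ (G ⊗ g)) i j ≡ form G (column g i) (column g j)
gram-entry G g i j = trans (entry-⊗ (transpose g) (G ⊗ g) i j)
  (cong sumℤ (tabulate-cong λ k → cong (lookup (column g i) k *_)
    (trans (entry-⊗ G g k j) (cong sumℤ (tabulate-cong λ l → cong (entry G k l *_) (sym (lookup-transpose g j l)))))))

isometry⇔preserves : ∀ (G g : Mat n) → (transpose g ⊗ (G ⊗ g) ≡ G) ⇔ Preserves G g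
isometry⇔preserves G g = mk⇔
  (λ eq i j → trans (sym (gram-entry G g i j)) (cong (λ M → entry M i j) eq))
  (λ p → matrix-ext λ i j → trans (gram-entry G g i j) (p i j))

sumℤ-zeros : sumℤ (tabulate {n = n} λ _ → 0ℤ) ≡ 0ℤ
sumℤ-zeros {zero}  = refl
sumℤ-zeros {suc n} = cong (_+_ 0ℤ) (sumℤ-zeros {n})

sumℤ-swap : ∀ {m} (f : Fin m → Fin n → ℤ) →
  sumℤ (tabulate λ i → sumℤ (tabulate (f i))) ≡ sumℤ (tabulate λ j → sumℤ (tabulate λ i → f i j))
sumℤ-swap {n = n} {m = zero} f = sym (sumℤ-zeros {n})
sumℤ-swap {m = suc m} f = trans (cong (_+_ (sumℤ (tabulate (f Fin.zero)))) (sumℤ-swap (f ∘ Fin.suc)))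
  (sym (sumℤ-+ (f Fin.zero) (λ j → sumℤ (tabulate λ i → f (Fin.suc i) j))))

form-column-⊗ : ∀ (G g h : Mat n) x j →
  form G x (column (g ⊗ h) j) ≡ sumℤ (tabulate λ k → entry h k j * form G x (column g k))
form-column-⊗ G g h x j = begin
  form G x (column (g ⊗ h) j)
    ≡⟨ cong sumℤ (tabulate-cong λ i → cong (lookup x i *_) (inner i)) ⟩
  sumℤ (tabulate λ i → lookup x i * sumℤ (tabulate λ k → entry h k j * row i k))
    ≡⟨ cong sumℤ (tabulate-cong λ i → trans (sym (sumℤ-* (lookup x i) (λ k → entry h k j * row i k)))
         (cong sumℤ (tabulate-cong λ k → reorder (lookup x i) (entry h k j) (row i k)))) ⟩
  sumℤ (tabulate λ i → sumℤ (tabulate λ k → entry h k j * (lookup x i * row i k)))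
    ≡⟨ sumℤ-swap (λ i k → entry h k j * (lookup x i * row i k)) ⟩
  sumℤ (tabulate λ k → sumℤ (tabulate λ i → entry h k j * (lookup x i * row i k)))
    ≡⟨ cong sumℤ (tabulate-cong λ k → sumℤ-* (entry h k j) (λ i → lookup x i * row i k)) ⟩
  sumℤ (tabulate λ k → entry h k j * form G x (column g k)) ∎
  where
  row : Fin _ → Fin _ → ℤ
  row i k = sumℤ (tabulate λ l → entry G i l * lookup (column g k) l)
  reorder : ∀ x c r → x * (c * r) ≡ c * (x * r)
  reorder = solve-∀
  reorderʳ : ∀ G u c → G * (u * c) ≡ c * (G * u)
  reorderʳ = solve-∀
  inner : ∀ i → sumℤ (tabulate λ l → entry G i l * lookup (column (g ⊗ h) j) l) ≡
                sumℤ (tabulate λ k → entry h k j * row i k)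
  inner i = begin
    sumℤ (tabulate λ l → entry G i l * lookup (column (g ⊗ h) j) l)
      ≡⟨ cong sumℤ (tabulate-cong λ l → cong (entry G i l *_)
           (trans (lookup-transpose (g ⊗ h) j l) (entry-⊗ g h l j))) ⟩
    sumℤ (tabulate λ l → entry G i l * sumℤ (tabulate λ k → entry g l k * entry h k j))
      ≡⟨ cong sumℤ (tabulate-cong λ l → trans (sym (sumℤ-* (entry G i l) (λ k → entry g l k * entry h k j)))
           (cong sumℤ (tabulate-cong λ k → reorderʳ (entry G i l) (entry g l k) (entry h k j)))) ⟩
    sumℤ (tabulate λ l → sumℤ (tabulate λ k → entry h k j * (entry G i l * entry g l k)))
      ≡⟨ sumℤ-swap (λ l k → entry h k j * (entry G i l * entry g l k)) ⟩
    sumℤ (tabulate λ k → sumℤ (tabulate λ l → entry h k j * (entry G i l * entry g l k)))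
      ≡⟨ cong sumℤ (tabulate-cong λ k → trans (sumℤ-* (entry h k j) (λ l → entry G i l * entry g l k))
           (cong (entry h k j *_) (cong sumℤ (tabulate-cong λ l →
             cong (entry G i l *_) (sym (lookup-transpose g k l)))))) ⟩
    sumℤ (tabulate λ k → entry h k j * row i k) ∎

preserves? : ∀ (G g : Mat n) → Dec (Preserves G g)
preserves? G g = all? λ i → all? λ j → form G (column g i) (column g j) ≟ entry G i j

preserves-combination : ∀ {G A E B F g} → LinearCombination {n} G A E B F →
  Preserves E g → Preserves F g → Preserves G g
preserves-combination {G = G} {A} {E} {B} {F} {g} comb@(entrywise comb-entry) pE pF i j = begin
  form G (column g i) (column g j)  ≡⟨ form-linear comb (column g i) (column g j) ⟩
  A * form E (column g i) (column g j) + B * form F (column g i) (column g j)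
    ≡⟨ cong₂ (λ e f → A * e + B * f) (pE i j) (pF i j) ⟩
  A * entry E i j + B * entry F i j ≡⟨ sym (comb-entry i j) ⟩
  entry G i j ∎

preserves-cancel : ∀ {G A E B F g} .{{_ : NonZero A}} → LinearCombination {n} G A E B F →
  Preserves G g → Preserves F g → Preserves E g
preserves-cancel {G = G} {A} {E} {B} {F} {g} comb@(entrywise comb-entry) pG pF i j =
  ℤ.*-cancelˡ-≡ A _ _ (∙-cancelʳ (B * entry F i j) _ _ (begin
    A * form E (column g i) (column g j) + B * entry F i j
      ≡⟨ cong (λ f → A * form E (column g i) (column g j) + B * f) (pF i j) ⟨
    A * form E (column g i) (column g j) + B * form F (column g i) (column g j)
      ≡⟨ form-linear comb (column g i) (column g j) ⟨
    form G (column g i) (column g j) ≡⟨ pG i j ⟩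
    entry G i j ≡⟨ comb-entry i j ⟩
    A * entry E i j + B * entry F i j ∎))

pattern mat₃ u₀ v₀ w₀ u₁ v₁ w₁ u₂ v₂ w₂ =
  (u₀ ∷ v₀ ∷ w₀ ∷ []) ∷ (u₁ ∷ v₁ ∷ w₁ ∷ []) ∷ (u₂ ∷ v₂ ∷ w₂ ∷ []) ∷ []

pattern #0 = Fin.zero
pattern #1 = Fin.suc #0
pattern #2 = Fin.suc #1

form₃ : ∀ G₀₀ G₀₁ G₀₂ G₁₀ G₁₁ G₁₂ G₂₀ G₂₁ G₂₂ x₀ x₁ x₂ y₀ y₁ y₂ →
  form (mat₃ G₀₀ G₀₁ G₀₂ G₁₀ G₁₁ G₁₂ G₂₀ G₂₁ G₂₂) (x₀ ∷ x₁ ∷ x₂ ∷ []) (y₀ ∷ y₁ ∷ y₂ ∷ []) ≡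
    x₀ * (G₀₀ * y₀ + G₀₁ * y₁ + G₀₂ * y₂) + x₁ * (G₁₀ * y₀ + G₁₁ * y₁ + G₁₂ * y₂)
      + x₂ * (G₂₀ * y₀ + G₂₁ * y₁ + G₂₂ * y₂)
form₃ G₀₀ G₀₁ G₀₂ G₁₀ G₁₁ G₁₂ G₂₀ G₂₁ G₂₂ x₀ x₁ x₂ y₀ y₁ y₂ =
  trans (sum₃ (x₀ * row G₀₀ G₀₁ G₀₂) (x₁ * row G₁₀ G₁₁ G₁₂) (x₂ * row G₂₀ G₂₁ G₂₂))
    (cong₂ _+_ (cong₂ _+_ (cong (x₀ *_) (sum₃ (G₀₀ * y₀) (G₀₁ * y₁) (G₀₂ * y₂)))
                          (cong (x₁ *_) (sum₃ (G₁₀ * y₀) (G₁₁ * y₁) (G₁₂ * y₂))))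
               (cong (x₂ *_) (sum₃ (G₂₀ * y₀) (G₂₁ * y₁) (G₂₂ * y₂))))
  where
  row : ℤ → ℤ → ℤ → ℤ
  row a b c = a * y₀ + (b * y₁ + (c * y₂ + 0ℤ))
  sum₃ : ∀ x y z → x + (y + (z + 0ℤ)) ≡ x + y + z
  sum₃ = solve-∀

form-K₃10 : ∀ x₀ x₁ x₂ y₀ y₁ y₂ →
  form (K₃ 1 0) (x₀ ∷ x₁ ∷ x₂ ∷ []) (y₀ ∷ y₁ ∷ y₂ ∷ []) ≡ x₀ * y₀ + x₁ * y₁
form-K₃10 x₀ x₁ x₂ y₀ y₁ y₂ =
  trans (form₃ 1ℤ 0ℤ 0ℤ 0ℤ 1ℤ 0ℤ 0ℤ 0ℤ 0ℤ x₀ x₁ x₂ y₀ y₁ y₂)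
        (solve (toList (x₀ ∷ x₁ ∷ x₂ ∷ y₀ ∷ y₁ ∷ y₂ ∷ [])))

form-K₃01 : ∀ x₀ x₁ x₂ y₀ y₁ y₂ →
  form (K₃ 0 1) (x₀ ∷ x₁ ∷ x₂ ∷ []) (y₀ ∷ y₁ ∷ y₂ ∷ []) ≡ x₂ * y₂
form-K₃01 x₀ x₁ x₂ y₀ y₁ y₂ =
  trans (form₃ 0ℤ 0ℤ 0ℤ 0ℤ 0ℤ 0ℤ 0ℤ 0ℤ 1ℤ x₀ x₁ x₂ y₀ y₁ y₂)
        (solve (toList (x₀ ∷ x₁ ∷ x₂ ∷ y₀ ∷ y₁ ∷ y₂ ∷ [])))

form-K₄10 : ∀ x₀ x₁ x₂ y₀ y₁ y₂ → form (K₄ 1 0) (x₀ ∷ x₁ ∷ x₂ ∷ []) (y₀ ∷ y₁ ∷ y₂ ∷ []) ≡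
  + 2 * (x₀ * y₀ + x₁ * y₁) - (x₀ + x₁) * y₂ - x₂ * (y₀ + y₁)
form-K₄10 x₀ x₁ x₂ y₀ y₁ y₂ =
  trans (form₃ (+ 2) 0ℤ -1ℤ 0ℤ (+ 2) -1ℤ -1ℤ -1ℤ 0ℤ x₀ x₁ x₂ y₀ y₁ y₂)
        (solve (toList (x₀ ∷ x₁ ∷ x₂ ∷ y₀ ∷ y₁ ∷ y₂ ∷ [])))

scale₁₀ : ∀ A B → A ≡ A * 1ℤ + B * 0ℤ
scale₁₀ = solve-∀

scale₀₁ : ∀ A B → B ≡ A * 0ℤ + B * 1ℤ
scale₀₁ = solve-∀

scale₀₀ : ∀ A B → 0ℤ ≡ A * 0ℤ + B * 0ℤ
scale₀₀ = solve-∀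

scale₂₀ : ∀ A B → + 2 * A ≡ A * + 2 + B * 0ℤ
scale₂₀ = solve-∀

scale₋₁₀ : ∀ A B → - A ≡ A * -1ℤ + B * 0ℤ
scale₋₁₀ = solve-∀

K₃-linear : ∀ a b → LinearCombination (K₃ a b) (+ a) (K₃ 1 0) (+ b) (K₃ 0 1)
K₃-linear a b = entrywise λ where
  #0 #0 → scale₁₀ (+ a) (+ b)
  #0 #1 → scale₀₀ (+ a) (+ b)
  #0 #2 → scale₀₀ (+ a) (+ b)
  #1 #0 → scale₀₀ (+ a) (+ b)
  #1 #1 → scale₁₀ (+ a) (+ b)
  #1 #2 → scale₀₀ (+ a) (+ b)
  #2 #0 → scale₀₀ (+ a) (+ b)
  #2 #1 → scale₀₀ (+ a) (+ b)
  #2 #2 → scale₀₁ (+ a) (+ b)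

-- K₄(0,1) and K₃(0,1) are the same matrix ⟨0,0,1⟩.
K₄-linear : ∀ a b → LinearCombination (K₄ a b) (+ a) (K₄ 1 0) (+ b) (K₃ 0 1)
K₄-linear a b = entrywise λ where
  #0 #0 → scale₂₀ (+ a) (+ b)
  #0 #1 → scale₀₀ (+ a) (+ b)
  #0 #2 → scale₋₁₀ (+ a) (+ b)
  #1 #0 → scale₀₀ (+ a) (+ b)
  #1 #1 → scale₂₀ (+ a) (+ b)
  #1 #2 → scale₋₁₀ (+ a) (+ b)
  #2 #0 → scale₋₁₀ (+ a) (+ b)
  #2 #1 → scale₋₁₀ (+ a) (+ b)
  #2 #2 → scale₀₁ (+ a) (+ b)

form-K₄10-e₃ : ∀ x₀ x₁ x₂ → form (K₄ 1 0) (x₀ ∷ x₁ ∷ x₂ ∷ []) (0ℤ ∷ 0ℤ ∷ 1ℤ ∷ []) ≡ - (x₀ + x₁)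
form-K₄10-e₃ x₀ x₁ x₂ = trans (form-K₄10 x₀ x₁ x₂ 0ℤ 0ℤ 1ℤ) (solve (toList (x₀ ∷ x₁ ∷ x₂ ∷ [])))

form-K₃01-e₃ : ∀ x₀ x₁ x₂ → form (K₃ 0 1) (x₀ ∷ x₁ ∷ x₂ ∷ []) (0ℤ ∷ 0ℤ ∷ 1ℤ ∷ []) ≡ x₂
form-K₃01-e₃ x₀ x₁ x₂ = trans (form-K₃01 x₀ x₁ x₂ 0ℤ 0ℤ 1ℤ) (ℤ.*-identityʳ x₂)

-- Integers of small norm

∣_∣² : ℤ → ℕ
∣ x ∣² = ∣ x ∣ ℕ.* ∣ x ∣

square : ∀ x → x * x ≡ + ∣ x ∣²
square +0       = refl
square +[1+ n ] = refl
square -[1+ n ] = refl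

sum-of-squares : ∀ x y → x * x + y * y ≡ + (∣ x ∣² ℕ.+ ∣ y ∣²)
sum-of-squares x y = cong₂ _+_ (square x) (square y)

∣∣²≡0⇒≡0 : ∀ x → ∣ x ∣² ≡ 0 → x ≡ 0ℤ
∣∣²≡0⇒≡0 x eq = ℤ.∣i∣≡0⇒i≡0 ([ id , id ]′ (ℕ.m*n≡0⇒m≡0∨n≡0 ∣ x ∣ eq))

units : List (ℤ × ℤ)
units = (1ℤ , 0ℤ) ∷ (-1ℤ , 0ℤ) ∷ (0ℤ , 1ℤ) ∷ (0ℤ , -1ℤ) ∷ []

signs : List ℤ
signs = 1ℤ ∷ -1ℤ ∷ []

trits : List ℤ
trits = -1ℤ ∷ 0ℤ ∷ 1ℤ ∷ []

∣∣≡1⇒∈signs : ∀ x → ∣ x ∣ ≡ 1 → x ∈ signs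
∣∣≡1⇒∈signs +[1+ 0 ] _ = here refl
∣∣≡1⇒∈signs -[1+ 0 ] _ = there (here refl)
∣∣≡1⇒∈signs +0 ()
∣∣≡1⇒∈signs +[1+ suc n ] ()
∣∣≡1⇒∈signs -[1+ suc n ] ()

*≡1⇒∈signs : ∀ x y → x * y ≡ 1ℤ → x ∈ signs
*≡1⇒∈signs x y eq = ∣∣≡1⇒∈signs x (ℕ.m*n≡1⇒m≡1 ∣ x ∣ ∣ y ∣ (trans (sym (ℤ.abs-* x y)) (cong ∣_∣ eq)))

∣∣²≡1⇒∈signs : ∀ x → ∣ x ∣² ≡ 1 → x ∈ signs
∣∣²≡1⇒∈signs x eq = ∣∣≡1⇒∈signs x (ℕ.m*n≡1⇒m≡1 ∣ x ∣ ∣ x ∣ eq)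

unit-vector : ∀ x y → ∣ x ∣² ℕ.+ ∣ y ∣² ≡ 1 → (x , y) ∈ units
unit-vector +[1+ 0 ] +0 _ = here refl
unit-vector -[1+ 0 ] +0 _ = there (here refl)
unit-vector +0 +[1+ 0 ] _ = there (there (here refl))
unit-vector +0 -[1+ 0 ] _ = there (there (there (here refl)))
unit-vector +0 +0 ()
unit-vector +0 +[1+ suc n ] ()
unit-vector +0 -[1+ suc n ] ()
unit-vector +[1+ 0 ] +[1+ n ] ()
unit-vector +[1+ 0 ] -[1+ n ] ()
unit-vector -[1+ 0 ] +[1+ n ] ()
unit-vector -[1+ 0 ] -[1+ n ] ()
unit-vector +[1+ suc m ] y ()
unit-vector -[1+ suc m ] y ()

big-square : ∀ n k → suc (suc n) ℕ.* suc (suc n) ℕ.+ k ≢ 2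
big-square n k eq with ℕ.m+n≡0⇒n≡0 n (ℕ.m+n≡0⇒m≡0 _ (ℕ.suc-injective (ℕ.suc-injective eq)))
... | ()

two-squares : ∀ x y → ∣ x ∣² ℕ.+ ∣ y ∣² ≡ 2 → x ∈ signs
two-squares +[1+ 0 ] y _ = here refl
two-squares -[1+ 0 ] y _ = there (here refl)
two-squares +[1+ suc m ] y eq = contradiction eq (big-square m ∣ y ∣²)
two-squares -[1+ suc m ] y eq = contradiction eq (big-square m ∣ y ∣²)
two-squares +0 +[1+ suc n ] eq = contradiction (trans (ℕ.+-identityʳ _) eq) (big-square n 0)
two-squares +0 -[1+ suc n ] eq = contradiction (trans (ℕ.+-identityʳ _) eq) (big-square n 0)
two-squares +0 +0 ()
two-squares +0 +[1+ 0 ] ()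
two-squares +0 -[1+ 0 ] ()


sign≢0 : ∀ {s} → s ∈ signs → s ≢ 0ℤ
sign≢0 (here refl) ()
sign≢0 (there (here refl)) ()

halve : ∀ {x s p} → s ∈ signs → p ∈ signs → + 2 * x - s ≡ p → x ∈ trits
halve {x} {s} {p} s∈ p∈ eq = go s∈ p∈ (trans (shift (+ 2 * x) s) (cong (λ z → z + s) eq))
  where
  shift : ∀ a s → a ≡ (a - s) + s
  shift = solve-∀
  go : s ∈ signs → p ∈ signs → + 2 * x ≡ p + s → x ∈ trits
  go (here refl)         (here refl)         e = there (there (here (ℤ.*-cancelˡ-≡ (+ 2) x 1ℤ e)))
  go (here refl)         (there (here refl)) e = there (here (ℤ.*-cancelˡ-≡ (+ 2) x 0ℤ e))
  go (there (here refl)) (here refl)         e = there (here (ℤ.*-cancelˡ-≡ (+ 2) x 0ℤ e))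
  go (there (here refl)) (there (here refl)) e = here (ℤ.*-cancelˡ-≡ (+ 2) x -1ℤ e)

form-K₃01-lookup : ∀ (x y : Vec ℤ 3) → form (K₃ 0 1) x y ≡ lookup x #2 * lookup y #2
form-K₃01-lookup (x₀ ∷ x₁ ∷ x₂ ∷ []) (y₀ ∷ y₁ ∷ y₂ ∷ []) = form-K₃01 x₀ x₁ x₂ y₀ y₁ y₂

*-self≡0⇒≡0 : ∀ x → x * x ≡ 0ℤ → x ≡ 0ℤ
*-self≡0⇒≡0 x eq = [ id , id ]′ (ℤ.i*j≡0⇒i≡0∨j≡0 x eq)

preserves-K₃01⇔ : ∀ {u₀ v₀ w₀ u₁ v₁ w₁ u₂ v₂ w₂} →
  Preserves (K₃ 0 1) (mat₃ u₀ v₀ w₀ u₁ v₁ w₁ u₂ v₂ w₂) ⇔ (u₂ ≡ 0ℤ × v₂ ≡ 0ℤ × w₂ ∈ signs)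
preserves-K₃01⇔ {u₀} {v₀} {w₀} {u₁} {v₁} {w₁} {u₂} {v₂} {w₂} = mk⇔ to from
  where
  g : Mat 3
  g = mat₃ u₀ v₀ w₀ u₁ v₁ w₁ u₂ v₂ w₂
  to : Preserves (K₃ 0 1) g → u₂ ≡ 0ℤ × v₂ ≡ 0ℤ × w₂ ∈ signs
  to p = *-self≡0⇒≡0 u₂ (trans (sym (form-K₃01 u₀ u₁ u₂ u₀ u₁ u₂)) (p #0 #0))
       , *-self≡0⇒≡0 v₂ (trans (sym (form-K₃01 v₀ v₁ v₂ v₀ v₁ v₂)) (p #1 #1))
       , *≡1⇒∈signs w₂ w₂ (trans (sym (form-K₃01 w₀ w₁ w₂ w₀ w₁ w₂)) (p #2 #2))
  bottom-row : ∀ {s} → s ∈ signs → ∀ i j →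
    lookup (0ℤ ∷ 0ℤ ∷ s ∷ []) i * lookup (0ℤ ∷ 0ℤ ∷ s ∷ []) j ≡ entry (K₃ 0 1) i j
  bottom-row (here refl)         = toWitness {a? = all? λ i → all? λ j → _ ≟ _} _
  bottom-row (there (here refl)) = toWitness {a? = all? λ i → all? λ j → _ ≟ _} _
  from : u₂ ≡ 0ℤ × v₂ ≡ 0ℤ × w₂ ∈ signs → Preserves (K₃ 0 1) g
  from (refl , refl , s) i j = trans (form-K₃01-lookup (column g i) (column g j))
    (trans (cong₂ _*_ (lookup-transpose g i #2) (lookup-transpose g j #2)) (bottom-row s i j))

-- The two groups of order 16

infix 4 _≟ᴹ_
_≟ᴹ_ : DecidableEquality (Mat 3)
_≟ᴹ_ = ≡-dec (≡-dec _≟_)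

open DecMembership _≟ᴹ_ using (_∈?_)

Inverse : Mat 3 → Mat 3 → Set
Inverse g h = g ⊗ h ≡ identity × h ⊗ g ≡ identity

Listed : Mat 3 → Mat 3 → List (Mat 3) → Mat 3 → Set
Listed E F gs g = Preserves E g × Preserves F g × Any (Inverse g) gs

listed? : ∀ E F gs g → Dec (Listed E F gs g)
listed? E F gs g = preserves? E g ×-dec preserves? F g ×-dec Any.any? inverse? gs
  where
  inverse? : ∀ h → Dec (Inverse g h)
  inverse? h = (g ⊗ h ≟ᴹ identity) ×-dec (h ⊗ g ≟ᴹ identity)

K₃-isometries : List (Mat 3)
K₃-isometries =
    mat₃  1ℤ  0ℤ  0ℤ  0ℤ  1ℤ  0ℤ  0ℤ  0ℤ  1ℤ
  ∷ mat₃  1ℤ  0ℤ  0ℤ  0ℤ  1ℤ  0ℤ  0ℤ  0ℤ -1ℤ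
  ∷ mat₃  1ℤ  0ℤ  0ℤ  0ℤ -1ℤ  0ℤ  0ℤ  0ℤ  1ℤ
  ∷ mat₃  1ℤ  0ℤ  0ℤ  0ℤ -1ℤ  0ℤ  0ℤ  0ℤ -1ℤ
  ∷ mat₃ -1ℤ  0ℤ  0ℤ  0ℤ  1ℤ  0ℤ  0ℤ  0ℤ  1ℤ
  ∷ mat₃ -1ℤ  0ℤ  0ℤ  0ℤ  1ℤ  0ℤ  0ℤ  0ℤ -1ℤ
  ∷ mat₃ -1ℤ  0ℤ  0ℤ  0ℤ -1ℤ  0ℤ  0ℤ  0ℤ  1ℤ
  ∷ mat₃ -1ℤ  0ℤ  0ℤ  0ℤ -1ℤ  0ℤ  0ℤ  0ℤ -1ℤ
  ∷ mat₃  0ℤ  1ℤ  0ℤ  1ℤ  0ℤ  0ℤ  0ℤ  0ℤ  1ℤ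
  ∷ mat₃  0ℤ  1ℤ  0ℤ  1ℤ  0ℤ  0ℤ  0ℤ  0ℤ -1ℤ
  ∷ mat₃  0ℤ -1ℤ  0ℤ  1ℤ  0ℤ  0ℤ  0ℤ  0ℤ  1ℤ
  ∷ mat₃  0ℤ -1ℤ  0ℤ  1ℤ  0ℤ  0ℤ  0ℤ  0ℤ -1ℤ
  ∷ mat₃  0ℤ  1ℤ  0ℤ -1ℤ  0ℤ  0ℤ  0ℤ  0ℤ  1ℤ
  ∷ mat₃  0ℤ  1ℤ  0ℤ -1ℤ  0ℤ  0ℤ  0ℤ  0ℤ -1ℤ
  ∷ mat₃  0ℤ -1ℤ  0ℤ -1ℤ  0ℤ  0ℤ  0ℤ  0ℤ  1ℤ
  ∷ mat₃  0ℤ -1ℤ  0ℤ -1ℤ  0ℤ  0ℤ  0ℤ  0ℤ -1ℤ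
  ∷ []

K₄-isometries : List (Mat 3)
K₄-isometries =
    mat₃  1ℤ  0ℤ  0ℤ  0ℤ  1ℤ  0ℤ  0ℤ  0ℤ  1ℤ
  ∷ mat₃  1ℤ  0ℤ -1ℤ  0ℤ  1ℤ -1ℤ  0ℤ  0ℤ -1ℤ
  ∷ mat₃  1ℤ  0ℤ  0ℤ  0ℤ -1ℤ  1ℤ  0ℤ  0ℤ  1ℤ
  ∷ mat₃  1ℤ  0ℤ -1ℤ  0ℤ -1ℤ  0ℤ  0ℤ  0ℤ -1ℤ
  ∷ mat₃ -1ℤ  0ℤ  1ℤ  0ℤ  1ℤ  0ℤ  0ℤ  0ℤ  1ℤ
  ∷ mat₃ -1ℤ  0ℤ  0ℤ  0ℤ  1ℤ -1ℤ  0ℤ  0ℤ -1ℤ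
  ∷ mat₃ -1ℤ  0ℤ  1ℤ  0ℤ -1ℤ  1ℤ  0ℤ  0ℤ  1ℤ
  ∷ mat₃ -1ℤ  0ℤ  0ℤ  0ℤ -1ℤ  0ℤ  0ℤ  0ℤ -1ℤ
  ∷ mat₃  0ℤ  1ℤ  0ℤ  1ℤ  0ℤ  0ℤ  0ℤ  0ℤ  1ℤ
  ∷ mat₃  0ℤ  1ℤ -1ℤ  1ℤ  0ℤ -1ℤ  0ℤ  0ℤ -1ℤ
  ∷ mat₃  0ℤ -1ℤ  1ℤ  1ℤ  0ℤ  0ℤ  0ℤ  0ℤ  1ℤ
  ∷ mat₃  0ℤ -1ℤ  0ℤ  1ℤ  0ℤ -1ℤ  0ℤ  0ℤ -1ℤ
  ∷ mat₃  0ℤ  1ℤ  0ℤ -1ℤ  0ℤ  1ℤ  0ℤ  0ℤ  1ℤ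
  ∷ mat₃  0ℤ  1ℤ -1ℤ -1ℤ  0ℤ  0ℤ  0ℤ  0ℤ -1ℤ
  ∷ mat₃  0ℤ -1ℤ  1ℤ -1ℤ  0ℤ  1ℤ  0ℤ  0ℤ  1ℤ
  ∷ mat₃  0ℤ -1ℤ  0ℤ -1ℤ  0ℤ  0ℤ  0ℤ  0ℤ -1ℤ
  ∷ []

completion : ℤ × ℤ → ℤ × ℤ → ℤ × ℤ × ℤ → Mat 3
completion (x₀ , x₁) (y₀ , y₁) (w₀ , w₁ , s) = mat₃ x₀ y₀ w₀ x₁ y₁ w₁ 0ℤ 0ℤ s

K₃-unique : Unique K₃-isometries
K₃-unique = toWitness {a? = unique? _≟ᴹ_ K₃-isometries} _

K₃-listed : All (Listed (K₃ 1 0) (K₃ 0 1) K₃-isometries) K₃-isometries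
K₃-listed = toWitness {a? = All.all? (listed? (K₃ 1 0) (K₃ 0 1) K₃-isometries) K₃-isometries} _

K₃-completions : ∀ {x y s} → x ∈ units → y ∈ units → s ∈ signs →
  Preserves (K₃ 1 0) (completion x y (0ℤ , 0ℤ , s)) → completion x y (0ℤ , 0ℤ , s) ∈ K₃-isometries
K₃-completions x∈ y∈ s∈ = All.lookup (All.lookup (All.lookup checked x∈) y∈) s∈
  where
  Completes : ℤ × ℤ → ℤ × ℤ → ℤ → Set
  Completes x y s = Preserves (K₃ 1 0) (completion x y (0ℤ , 0ℤ , s)) → completion x y (0ℤ , 0ℤ , s) ∈ K₃-isometries
  completes? : ∀ x y s → Dec (Completes x y s)
  completes? x y s =
    preserves? (K₃ 1 0) (completion x y (0ℤ , 0ℤ , s)) →-dec (completion x y (0ℤ , 0ℤ , s) ∈? K₃-isometries)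
  checked : All (λ x → All (λ y → All (Completes x y) signs) units) units
  checked = toWitness {a? = All.all? (λ x → All.all? (λ y → All.all? (completes? x y) signs) units) units} _

K₄-unique : Unique K₄-isometries
K₄-unique = toWitness {a? = unique? _≟ᴹ_ K₄-isometries} _

K₄-listed : All (Listed (K₄ 1 0) (K₃ 0 1) K₄-isometries) K₄-isometries
K₄-listed = toWitness {a? = All.all? (listed? (K₄ 1 0) (K₃ 0 1) K₄-isometries) K₄-isometries} _

K₄-completions : ∀ {x y w₀ w₁ s} → x ∈ units → y ∈ units → w₀ ∈ trits → w₁ ∈ trits → s ∈ signs →
  Preserves (K₄ 1 0) (completion x y (w₀ , w₁ , s)) → completion x y (w₀ , w₁ , s) ∈ K₄-isometries
K₄-completions x∈ y∈ w₀∈ w₁∈ s∈ =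
  All.lookup (All.lookup (All.lookup (All.lookup (All.lookup checked x∈) y∈) w₀∈) w₁∈) s∈
  where
  Completes : ℤ × ℤ → ℤ × ℤ → ℤ → ℤ → ℤ → Set
  Completes x y w₀ w₁ s = Preserves (K₄ 1 0) (completion x y (w₀ , w₁ , s)) → completion x y (w₀ , w₁ , s) ∈ K₄-isometries
  completes? : ∀ x y w₀ w₁ s → Dec (Completes x y w₀ w₁ s)
  completes? x y w₀ w₁ s =
    preserves? (K₄ 1 0) (completion x y (w₀ , w₁ , s)) →-dec (completion x y (w₀ , w₁ , s) ∈? K₄-isometries)
  checked : All (λ x → All (λ y → All (λ w₀ → All (λ w₁ → All (Completes x y w₀ w₁) signs) trits) trits) units) units
  checked = toWitness {a? = All.all? (λ x → All.all? (λ y → All.all? (λ w₀ → All.all? (λ w₁ →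
    All.all? (completes? x y w₀ w₁) signs) trits) trits) units) units} _

plane-norm : ∀ x₀ x₁ x₂ {n} → form (K₃ 1 0) (x₀ ∷ x₁ ∷ x₂ ∷ []) (x₀ ∷ x₁ ∷ x₂ ∷ []) ≡ + n →
  ∣ x₀ ∣² ℕ.+ ∣ x₁ ∣² ≡ n
plane-norm x₀ x₁ x₂ eq = ℤ.+-injective (trans (sym (sum-of-squares x₀ x₁)) (trans (sym (form-K₃10 x₀ x₁ x₂ x₀ x₁ x₂)) eq))

plane-isotropic : ∀ x₀ x₁ x₂ → form (K₃ 1 0) (x₀ ∷ x₁ ∷ x₂ ∷ []) (x₀ ∷ x₁ ∷ x₂ ∷ []) ≡ 0ℤ →
  x₀ ≡ 0ℤ × x₁ ≡ 0ℤ
plane-isotropic x₀ x₁ x₂ eq =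
  ∣∣²≡0⇒≡0 x₀ (ℕ.m+n≡0⇒m≡0 _ norm) , ∣∣²≡0⇒≡0 x₁ (ℕ.m+n≡0⇒n≡0 ∣ x₀ ∣² norm)
  where
  norm : ∣ x₀ ∣² ℕ.+ ∣ x₁ ∣² ≡ 0
  norm = plane-norm x₀ x₁ x₂ eq

K₃-completion-∈ : ∀ {u₀ v₀ w₀ u₁ v₁ w₁ u₂ v₂ w₂} →
  u₂ ≡ 0ℤ × v₂ ≡ 0ℤ × w₂ ∈ signs → w₀ ≡ 0ℤ × w₁ ≡ 0ℤ →
  Preserves (K₃ 1 0) (mat₃ u₀ v₀ w₀ u₁ v₁ w₁ u₂ v₂ w₂) → mat₃ u₀ v₀ w₀ u₁ v₁ w₁ u₂ v₂ w₂ ∈ K₃-isometries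
K₃-completion-∈ {u₀} {v₀} {u₁ = u₁} {v₁} (refl , refl , w₂∈) (refl , refl) plane =
  K₃-completions (unit-vector u₀ u₁ (plane-norm u₀ u₁ 0ℤ (plane #0 #0)))
                 (unit-vector v₀ v₁ (plane-norm v₀ v₁ 0ℤ (plane #1 #1))) w₂∈ plane

K₃-parts⇒∈ : ∀ g → Preserves (K₃ 0 1) g → Preserves (K₃ 1 0) g → g ∈ K₃-isometries
K₃-parts⇒∈ (mat₃ u₀ v₀ w₀ u₁ v₁ w₁ u₂ v₂ w₂) axis plane =
  K₃-completion-∈ (Equivalence.to preserves-K₃01⇔ axis) (plane-isotropic w₀ w₁ w₂ (plane #2 #2)) plane

form-K₄10-horizontal : ∀ x₀ x₁ →
  form (K₄ 1 0) (x₀ ∷ x₁ ∷ 0ℤ ∷ []) (x₀ ∷ x₁ ∷ 0ℤ ∷ []) ≡ + 2 * (x₀ * x₀ + x₁ * x₁)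
form-K₄10-horizontal x₀ x₁ = trans (form-K₄10 x₀ x₁ 0ℤ x₀ x₁ 0ℤ) (solve (toList (x₀ ∷ x₁ ∷ [])))

form-K₄10-square : ∀ x₀ x₁ x₂ →
  + 2 * form (K₄ 1 0) (x₀ ∷ x₁ ∷ x₂ ∷ []) (x₀ ∷ x₁ ∷ x₂ ∷ []) + + 2 * (x₂ * x₂)
    ≡ (+ 2 * x₀ - x₂) * (+ 2 * x₀ - x₂) + (+ 2 * x₁ - x₂) * (+ 2 * x₁ - x₂)
form-K₄10-square x₀ x₁ x₂ =
  trans (cong (λ f → + 2 * f + + 2 * (x₂ * x₂)) (form-K₄10 x₀ x₁ x₂ x₀ x₁ x₂)) (solve (toList (x₀ ∷ x₁ ∷ x₂ ∷ [])))

sign-square : ∀ {s} → s ∈ signs → s * s ≡ 1ℤ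
sign-square (here refl)         = refl
sign-square (there (here refl)) = refl

tilted-norm : ∀ x₀ x₁ → form (K₄ 1 0) (x₀ ∷ x₁ ∷ 0ℤ ∷ []) (x₀ ∷ x₁ ∷ 0ℤ ∷ []) ≡ + 2 →
  ∣ x₀ ∣² ℕ.+ ∣ x₁ ∣² ≡ 1
tilted-norm x₀ x₁ eq = ℤ.+-injective (ℤ.*-cancelˡ-≡ (+ 2) _ 1ℤ
  (trans (cong (+ 2 *_) (sym (sum-of-squares x₀ x₁))) (trans (sym (form-K₄10-horizontal x₀ x₁)) eq)))

tilted-isotropic : ∀ {w₀ w₁ s} → s ∈ signs →
  form (K₄ 1 0) (w₀ ∷ w₁ ∷ s ∷ []) (w₀ ∷ w₁ ∷ s ∷ []) ≡ 0ℤ → w₀ ∈ trits × w₁ ∈ trits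
tilted-isotropic {w₀} {w₁} {s} s∈ eq =
    halve s∈ (two-squares p q norm) refl
  , halve s∈ (two-squares q p (trans (ℕ.+-comm ∣ q ∣² ∣ p ∣²) norm)) refl
  where
  p q : ℤ
  p = + 2 * w₀ - s
  q = + 2 * w₁ - s
  norm : ∣ p ∣² ℕ.+ ∣ q ∣² ≡ 2
  norm = ℤ.+-injective (trans (sym (sum-of-squares p q)) (trans (sym (form-K₄10-square w₀ w₁ s))
           (trans (cong (λ f → + 2 * f + + 2 * (s * s)) eq) (cong (λ t → + 2 * 0ℤ + + 2 * t) (sign-square s∈)))))

K₄-completion-∈ : ∀ {u₀ v₀ w₀ u₁ v₁ w₁ u₂ v₂ w₂} → u₂ ≡ 0ℤ × v₂ ≡ 0ℤ × w₂ ∈ signs →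
  Preserves (K₄ 1 0) (mat₃ u₀ v₀ w₀ u₁ v₁ w₁ u₂ v₂ w₂) → mat₃ u₀ v₀ w₀ u₁ v₁ w₁ u₂ v₂ w₂ ∈ K₄-isometries
K₄-completion-∈ {u₀} {v₀} {w₀} {u₁} {v₁} {w₁} (refl , refl , w₂∈) tilted =
  K₄-completions (unit-vector u₀ u₁ (tilted-norm u₀ u₁ (tilted #0 #0)))
                 (unit-vector v₀ v₁ (tilted-norm v₀ v₁ (tilted #1 #1)))
                 (proj₁ w-trits) (proj₂ w-trits) w₂∈ tilted
  where
  w-trits : w₀ ∈ trits × w₁ ∈ trits
  w-trits = tilted-isotropic w₂∈ (tilted #2 #2)

K₄-parts⇒∈ : ∀ g → Preserves (K₃ 0 1) g → Preserves (K₄ 1 0) g → g ∈ K₄-isometries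
K₄-parts⇒∈ (mat₃ u₀ v₀ w₀ u₁ v₁ w₁ u₂ v₂ w₂) axis tilted =
  K₄-completion-∈ (Equivalence.to preserves-K₃01⇔ axis) tilted

-- The third row of an isometry of K₃

K₃-bilinear : ∀ a b x₀ x₁ x₂ y₀ y₁ y₂ →
  form (K₃ a b) (x₀ ∷ x₁ ∷ x₂ ∷ []) (y₀ ∷ y₁ ∷ y₂ ∷ []) ≡ + a * (x₀ * y₀ + x₁ * y₁) + + b * (x₂ * y₂)
K₃-bilinear a b x₀ x₁ x₂ y₀ y₁ y₂ =
  trans (form-linear (K₃-linear a b) (x₀ ∷ x₁ ∷ x₂ ∷ []) (y₀ ∷ y₁ ∷ y₂ ∷ []))
  (cong₂ (λ p q → + a * p + + b * q) (form-K₃10 x₀ x₁ x₂ y₀ y₁ y₂) (form-K₃01 x₀ x₁ x₂ y₀ y₁ y₂))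

K₃-norm : ∀ a b x₀ x₁ x₂ → form (K₃ a b) (x₀ ∷ x₁ ∷ x₂ ∷ []) (x₀ ∷ x₁ ∷ x₂ ∷ []) ≡
  + (a ℕ.* (∣ x₀ ∣² ℕ.+ ∣ x₁ ∣²) ℕ.+ b ℕ.* ∣ x₂ ∣²)
K₃-norm a b x₀ x₁ x₂ = trans (K₃-bilinear a b x₀ x₁ x₂ x₀ x₁ x₂)
  (cong₂ _+_ (trans (cong (+ a *_) (sum-of-squares x₀ x₁)) (sym (ℤ.pos-* a _)))
             (trans (cong (+ b *_) (square x₂)) (sym (ℤ.pos-* b _))))

small-norm⇒zero : ∀ m n x y {k} → m ℕ.* x ℕ.+ n ℕ.* y ≡ k → k ℕ.< n → y ≡ 0
small-norm⇒zero m n x zero    eq k<n = refl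
small-norm⇒zero m n x (suc y) eq k<n = contradiction
  (ℕ.≤-trans (ℕ.m≤m*n n (suc y)) (ℕ.≤-trans (ℕ.m≤n+m _ (m ℕ.* x)) (ℕ.≤-reflexive eq))) (ℕ.<⇒≱ k<n)

corner-unit : ∀ {u₀ v₀ w₀ u₁ v₁ w₁ u₂ v₂ w₂} h → u₂ ≡ 0ℤ → v₂ ≡ 0ℤ →
  mat₃ u₀ v₀ w₀ u₁ v₁ w₁ u₂ v₂ w₂ ⊗ h ≡ identity → w₂ ∈ signs
corner-unit {w₂ = w₂} (mat₃ h₀₀ h₀₁ h₀₂ h₁₀ h₁₁ h₁₂ h₂₀ h₂₁ h₂₂) refl refl gh≡1 =
  *≡1⇒∈signs w₂ h₂₂ (trans (sym (bottom-right h₀₂ h₁₂ w₂ h₂₂)) (cong (λ M → entry M #2 #2) gh≡1))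
  where
  bottom-right : ∀ p q w h → 0ℤ * p + (0ℤ * q + (w * h + 0ℤ)) ≡ w * h
  bottom-right = solve-∀

K₃-short⇒horizontal : ∀ {a b} → a ℕ.< b → ∀ x₀ x₁ x₂ →
  form (K₃ a b) (x₀ ∷ x₁ ∷ x₂ ∷ []) (x₀ ∷ x₁ ∷ x₂ ∷ []) ≡ + a → x₂ ≡ 0ℤ
K₃-short⇒horizontal {a} {b} a<b x₀ x₁ x₂ eq = ∣∣²≡0⇒≡0 x₂
  (small-norm⇒zero a b (∣ x₀ ∣² ℕ.+ ∣ x₁ ∣²) ∣ x₂ ∣² (ℤ.+-injective (trans (sym (K₃-norm a b x₀ x₁ x₂)) eq)) a<b)

K₃-short⇒vertical : ∀ {a b} .{{_ : ℕ.NonZero b}} → b ℕ.< a → ∀ x₀ x₁ x₂ →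
  form (K₃ a b) (x₀ ∷ x₁ ∷ x₂ ∷ []) (x₀ ∷ x₁ ∷ x₂ ∷ []) ≡ + b → x₀ ≡ 0ℤ × x₁ ≡ 0ℤ × x₂ ∈ signs
K₃-short⇒vertical {a} {b} b<a x₀ x₁ x₂ eq =
    ∣∣²≡0⇒≡0 x₀ (ℕ.m+n≡0⇒m≡0 _ horizontal)
  , ∣∣²≡0⇒≡0 x₁ (ℕ.m+n≡0⇒n≡0 ∣ x₀ ∣² horizontal)
  , ∣∣²≡1⇒∈signs x₂ (ℕ.*-cancelˡ-≡ _ 1 b (trans vertical (sym (ℕ.*-identityʳ b))))
  where
  norm : a ℕ.* (∣ x₀ ∣² ℕ.+ ∣ x₁ ∣²) ℕ.+ b ℕ.* ∣ x₂ ∣² ≡ b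
  norm = ℤ.+-injective (trans (sym (K₃-norm a b x₀ x₁ x₂)) eq)
  horizontal : ∣ x₀ ∣² ℕ.+ ∣ x₁ ∣² ≡ 0
  horizontal = small-norm⇒zero b a ∣ x₂ ∣² (∣ x₀ ∣² ℕ.+ ∣ x₁ ∣²)
    (trans (ℕ.+-comm (b ℕ.* ∣ x₂ ∣²) (a ℕ.* (∣ x₀ ∣² ℕ.+ ∣ x₁ ∣²))) norm) b<a
  vertical : b ℕ.* ∣ x₂ ∣² ≡ b
  vertical = begin
    b ℕ.* ∣ x₂ ∣²                                     ≡⟨ cong (ℕ._+ b ℕ.* ∣ x₂ ∣²) (ℕ.*-zeroʳ a) ⟨
    a ℕ.* 0 ℕ.+ b ℕ.* ∣ x₂ ∣²                         ≡⟨ cong (λ n → a ℕ.* n ℕ.+ b ℕ.* ∣ x₂ ∣²) horizontal ⟨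
    a ℕ.* (∣ x₀ ∣² ℕ.+ ∣ x₁ ∣²) ℕ.+ b ℕ.* ∣ x₂ ∣²  ≡⟨ norm ⟩
    b                                                 ∎

K₃-orthogonal⇒horizontal : ∀ {a b} .{{_ : ℕ.NonZero b}} → ∀ x₀ x₁ x₂ {s} → s ∈ signs →
  form (K₃ a b) (x₀ ∷ x₁ ∷ x₂ ∷ []) (0ℤ ∷ 0ℤ ∷ s ∷ []) ≡ 0ℤ → x₂ ≡ 0ℤ
K₃-orthogonal⇒horizontal {a} {b} x₀ x₁ x₂ {s} s∈ eq =
  [ id , (λ s≡0 → contradiction s≡0 (sign≢0 s∈)) ]′ (ℤ.i*j≡0⇒i≡0∨j≡0 x₂ x₂s≡0)
  where
  vertical-part : ∀ A B x₀ x₁ y → A * (x₀ * 0ℤ + x₁ * 0ℤ) + B * y ≡ B * y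
  vertical-part = solve-∀
  x₂s≡0 : x₂ * s ≡ 0ℤ
  x₂s≡0 = ℤ.*-cancelˡ-≡ (+ b) _ 0ℤ (begin
    + b * (x₂ * s)                                        ≡⟨ vertical-part (+ a) (+ b) x₀ x₁ (x₂ * s) ⟨
    + a * (x₀ * 0ℤ + x₁ * 0ℤ) + + b * (x₂ * s)            ≡⟨ K₃-bilinear a b x₀ x₁ x₂ 0ℤ 0ℤ s ⟨
    form (K₃ a b) (x₀ ∷ x₁ ∷ x₂ ∷ []) (0ℤ ∷ 0ℤ ∷ s ∷ [])  ≡⟨ eq ⟩
    0ℤ                                                    ≡⟨ ℤ.*-zeroʳ (+ b) ⟨
    + b * 0ℤ                                              ∎)

K₃-axis-< : ∀ {a b g} → a ℕ.< b → IsIsometry (K₃ a b) g → Preserves (K₃ 0 1) g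
K₃-axis-< {a} {b} {g@(mat₃ u₀ v₀ w₀ u₁ v₁ w₁ u₂ v₂ w₂)} a<b ((h , gh≡1 , _) , isometry) =
  Equivalence.from preserves-K₃01⇔ (u₂≡0 , v₂≡0 , corner-unit {u₀} {v₀} {w₀} {u₁} {v₁} {w₁} h u₂≡0 v₂≡0 gh≡1)
  where
  preserves : Preserves (K₃ a b) g
  preserves = Equivalence.to (isometry⇔preserves (K₃ a b) g) isometry
  u₂≡0 : u₂ ≡ 0ℤ
  u₂≡0 = K₃-short⇒horizontal a<b u₀ u₁ u₂ (preserves #0 #0)
  v₂≡0 : v₂ ≡ 0ℤ
  v₂≡0 = K₃-short⇒horizontal a<b v₀ v₁ v₂ (preserves #1 #1)

K₃-orthogonal⇒axis : ∀ {a b u₀ v₀ w₀ u₁ v₁ w₁ u₂ v₂ w₂} .{{_ : ℕ.NonZero b}} →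
  w₀ ≡ 0ℤ × w₁ ≡ 0ℤ × w₂ ∈ signs → Preserves (K₃ a b) (mat₃ u₀ v₀ w₀ u₁ v₁ w₁ u₂ v₂ w₂) →
  Preserves (K₃ 0 1) (mat₃ u₀ v₀ w₀ u₁ v₁ w₁ u₂ v₂ w₂)
K₃-orthogonal⇒axis {a} {u₀ = u₀} {v₀} {u₁ = u₁} {v₁} {u₂ = u₂} {v₂} (refl , refl , w₂∈) preserves =
  Equivalence.from preserves-K₃01⇔
    ( K₃-orthogonal⇒horizontal {a} u₀ u₁ u₂ w₂∈ (preserves #0 #2)
    , K₃-orthogonal⇒horizontal {a} v₀ v₁ v₂ w₂∈ (preserves #1 #2)
    , w₂∈)

K₃-axis-> : ∀ {a b g} .{{_ : ℕ.NonZero b}} → b ℕ.< a → IsIsometry (K₃ a b) g → Preserves (K₃ 0 1) g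
K₃-axis-> {a} {b} {g@(mat₃ u₀ v₀ w₀ u₁ v₁ w₁ u₂ v₂ w₂)} b<a (_ , isometry) =
  K₃-orthogonal⇒axis (K₃-short⇒vertical b<a w₀ w₁ w₂ (preserves #2 #2)) preserves
  where
  preserves : Preserves (K₃ a b) g
  preserves = Equivalence.to (isometry⇔preserves (K₃ a b) g) isometry

-- The third row of an isometry of K₄

K₄-e₃ : ∀ a b x₀ x₁ x₂ →
  form (K₄ a b) (x₀ ∷ x₁ ∷ x₂ ∷ []) (0ℤ ∷ 0ℤ ∷ 1ℤ ∷ []) ≡ + b * x₂ - + a * (x₀ + x₁)
K₄-e₃ a b x₀ x₁ x₂ = begin
  form (K₄ a b) x e₃                              ≡⟨ form-linear (K₄-linear a b) x e₃ ⟩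
  + a * form (K₄ 1 0) x e₃ + + b * form (K₃ 0 1) x e₃
    ≡⟨ cong₂ (λ p q → + a * p + + b * q) (form-K₄10-e₃ x₀ x₁ x₂) (form-K₃01-e₃ x₀ x₁ x₂) ⟩
  + a * - (x₀ + x₁) + + b * x₂                      ≡⟨ rearrange (+ a) (+ b) (x₀ + x₁) x₂ ⟩
  + b * x₂ - + a * (x₀ + x₁)                        ∎
  where
  x e₃ : Vec ℤ 3
  x = x₀ ∷ x₁ ∷ x₂ ∷ []
  e₃ = 0ℤ ∷ 0ℤ ∷ 1ℤ ∷ []
  rearrange : ∀ A B s y → A * - s + B * y ≡ B * y - A * s
  rearrange = solve-∀

K₄-norm : ∀ a c x₀ x₁ x₂ → + 2 * form (K₄ a (a ℕ.+ c)) (x₀ ∷ x₁ ∷ x₂ ∷ []) (x₀ ∷ x₁ ∷ x₂ ∷ []) ≡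
  + (a ℕ.* (∣ + 2 * x₀ - x₂ ∣² ℕ.+ ∣ + 2 * x₁ - x₂ ∣²) ℕ.+ 2 ℕ.* c ℕ.* ∣ x₂ ∣²)
K₄-norm a c x₀ x₁ x₂ = begin
  + 2 * form (K₄ a (a ℕ.+ c)) x x
    ≡⟨ cong (+ 2 *_) (form-linear (K₄-linear a (a ℕ.+ c)) x x) ⟩
  + 2 * (+ a * form (K₄ 1 0) x x + (+ a + + c) * form (K₃ 0 1) x x)
    ≡⟨ cong (λ q → + 2 * (+ a * form (K₄ 1 0) x x + (+ a + + c) * q)) (form-K₃01 x₀ x₁ x₂ x₀ x₁ x₂) ⟩
  + 2 * (+ a * form (K₄ 1 0) x x + (+ a + + c) * (x₂ * x₂))
    ≡⟨ regroup (+ a) (+ c) (form (K₄ 1 0) x x) (x₂ * x₂) ⟩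
  + a * (+ 2 * form (K₄ 1 0) x x + + 2 * (x₂ * x₂)) + + 2 * + c * (x₂ * x₂)
    ≡⟨ cong (λ q → + a * q + + 2 * + c * (x₂ * x₂)) (form-K₄10-square x₀ x₁ x₂) ⟩
  + a * (P * P + R * R) + + 2 * + c * (x₂ * x₂)
    ≡⟨ cong₂ (λ q s → + a * q + + 2 * + c * s) (sum-of-squares P R) (square x₂) ⟩
  + a * + (∣ P ∣² ℕ.+ ∣ R ∣²) + + 2 * + c * + ∣ x₂ ∣²
    ≡⟨ cong₂ _+_ (ℤ.pos-* a _) (trans (ℤ.pos-* (2 ℕ.* c) _) (cong (_* + ∣ x₂ ∣²) (ℤ.pos-* 2 c))) ⟨
  + (a ℕ.* (∣ P ∣² ℕ.+ ∣ R ∣²) ℕ.+ 2 ℕ.* c ℕ.* ∣ x₂ ∣²) ∎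
  where
  x : Vec ℤ 3
  x = x₀ ∷ x₁ ∷ x₂ ∷ []
  P R : ℤ
  P = + 2 * x₀ - x₂
  R = + 2 * x₁ - x₂
  regroup : ∀ A C f s → + 2 * (A * f + (A + C) * s) ≡ A * (+ 2 * f + + 2 * s) + + 2 * C * s
  regroup = solve-∀

K₄-bottom-divisible : ∀ {a b} → Coprime a b → ∀ x₀ x₁ x₂ m →
  form (K₄ a b) (x₀ ∷ x₁ ∷ x₂ ∷ []) (0ℤ ∷ 0ℤ ∷ 1ℤ ∷ []) ≡ + a * m → a ∣ ∣ x₂ ∣
K₄-bottom-divisible {a} {b} coprime x₀ x₁ x₂ m eq = coprime-divisor coprime (divides ∣ k ∣ (begin
  b ℕ.* ∣ x₂ ∣     ≡⟨ ℤ.abs-* (+ b) x₂ ⟨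
  ∣ + b * x₂ ∣     ≡⟨ cong ∣_∣ bx₂≡ak ⟩
  ∣ + a * k ∣      ≡⟨ ℤ.abs-* (+ a) k ⟩
  a ℕ.* ∣ k ∣      ≡⟨ ℕ.*-comm a ∣ k ∣ ⟩
  ∣ k ∣ ℕ.* a      ∎))
  where
  k : ℤ
  k = m + (x₀ + x₁)
  shift : ∀ B y A s → B * y ≡ (B * y - A * s) + A * s
  shift = solve-∀
  bx₂≡ak : + b * x₂ ≡ + a * k
  bx₂≡ak = trans (shift (+ b) x₂ (+ a) (x₀ + x₁))
    (trans (cong (_+ + a * (x₀ + x₁)) (trans (sym (K₄-e₃ a b x₀ x₁ x₂)) eq)) (sym (ℤ.*-distribˡ-+ (+ a) m (x₀ + x₁))))

small-product : ∀ {a c t} → 0 ℕ.< a → 0 ℕ.< c → 0 ℕ.< t → c ℕ.* (t ℕ.* t) ℕ.* a ℕ.≤ 2 →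
  (a , c , t) ∈ (1 , 1 , 1) ∷ (2 , 1 , 1) ∷ (1 , 2 , 1) ∷ []
small-product {suc a} {suc c} {suc t} _ _ _ X≤2 = go a c t (bound a≤X) (bound c≤X) (bound t≤X) X≤2
  where
  X : ℕ
  X = suc c ℕ.* (suc t ℕ.* suc t) ℕ.* suc a
  bound : ∀ {n} → suc n ℕ.≤ X → n ℕ.≤ 1
  bound n<X = ℕ.≤-pred (ℕ.≤-trans n<X X≤2)
  a≤X : suc a ℕ.≤ X
  a≤X = ℕ.m≤n*m (suc a) (suc c ℕ.* (suc t ℕ.* suc t))
  c≤X : suc c ℕ.≤ X
  c≤X = ℕ.≤-trans (ℕ.m≤m*n (suc c) (suc t ℕ.* suc t)) (ℕ.m≤m*n _ (suc a))
  t≤X : suc t ℕ.≤ X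
  t≤X = ℕ.≤-trans (ℕ.m≤m*n (suc t) (suc t)) (ℕ.≤-trans (ℕ.m≤n*m _ (suc c)) (ℕ.m≤m*n _ (suc a)))
  go : ∀ a c t → a ℕ.≤ 1 → c ℕ.≤ 1 → t ℕ.≤ 1 → suc c ℕ.* (suc t ℕ.* suc t) ℕ.* suc a ℕ.≤ 2 →
    (suc a , suc c , suc t) ∈ (1 , 1 , 1) ∷ (2 , 1 , 1) ∷ (1 , 2 , 1) ∷ []
  go 0 0 0 _ _ _ _ = here refl
  go 1 0 0 _ _ _ _ = there (here refl)
  go 0 1 0 _ _ _ _ = there (there (here refl))
  go 1 1 0 _ _ _ (s≤s (s≤s ()))
  go 0 0 1 _ _ _ (s≤s (s≤s ()))
  go 1 0 1 _ _ _ (s≤s (s≤s ()))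
  go 0 1 1 _ _ _ (s≤s (s≤s ()))
  go 1 1 1 _ _ _ (s≤s (s≤s ()))
  go (suc (suc _)) _ _ (s≤s ()) _ _ _
  go _ (suc (suc _)) _ _ (s≤s ()) _ _
  go _ _ (suc (suc _)) _ _ (s≤s ()) _

even≢±1 : ∀ x₀ x₂ → + 2 * x₀ - x₂ ≡ 0ℤ → ∣ x₂ ∣ ≢ 1
even≢±1 x₀ x₂ eq ∣x₂∣≡1 with ℕ.m*n≡1⇒m≡1 2 ∣ x₀ ∣ (begin
  2 ℕ.* ∣ x₀ ∣    ≡⟨ ℤ.abs-* (+ 2) x₀ ⟨
  ∣ + 2 * x₀ ∣    ≡⟨ cong ∣_∣ (ℤ.i-j≡0⇒i≡j (+ 2 * x₀) x₂ eq) ⟩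
  ∣ x₂ ∣          ≡⟨ ∣x₂∣≡1 ⟩
  1               ∎)
... | ()

K₄-reduced-norm : ∀ {a c} → 0 ℕ.< a → ∀ x₀ x₁ x₂ t →
  form (K₄ a (a ℕ.+ c)) (x₀ ∷ x₁ ∷ x₂ ∷ []) (x₀ ∷ x₁ ∷ x₂ ∷ []) ≡ + 2 * + a → ∣ x₂ ∣ ≡ t ℕ.* a →
  ∣ + 2 * x₀ - x₂ ∣² ℕ.+ ∣ + 2 * x₁ - x₂ ∣² ℕ.+ 2 ℕ.* (c ℕ.* (t ℕ.* t) ℕ.* a) ≡ 4
K₄-reduced-norm {a} {c} 0<a x₀ x₁ x₂ t norm ∣x₂∣≡ta = ℕ.*-cancelˡ-≡ _ 4 a {{ℕ.>-nonZero 0<a}} (begin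
  a ℕ.* (p ℕ.+ r ℕ.+ 2 ℕ.* (c ℕ.* (t ℕ.* t) ℕ.* a))   ≡⟨ expand a c t p r ⟩
  a ℕ.* (p ℕ.+ r) ℕ.+ 2 ℕ.* c ℕ.* ((t ℕ.* a) ℕ.* (t ℕ.* a))
    ≡⟨ cong (λ n → a ℕ.* (p ℕ.+ r) ℕ.+ 2 ℕ.* c ℕ.* (n ℕ.* n)) ∣x₂∣≡ta ⟨
  a ℕ.* (p ℕ.+ r) ℕ.+ 2 ℕ.* c ℕ.* ∣ x₂ ∣²             ≡⟨ ℤ.+-injective integral ⟩
  2 ℕ.* (2 ℕ.* a)                                      ≡⟨ quadruple a ⟩
  a ℕ.* 4                                              ∎)
  where
  p r : ℕ
  p = ∣ + 2 * x₀ - x₂ ∣²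
  r = ∣ + 2 * x₁ - x₂ ∣²
  expand : ∀ a c t p r →
    a ℕ.* (p ℕ.+ r ℕ.+ 2 ℕ.* (c ℕ.* (t ℕ.* t) ℕ.* a)) ≡ a ℕ.* (p ℕ.+ r) ℕ.+ 2 ℕ.* c ℕ.* ((t ℕ.* a) ℕ.* (t ℕ.* a))
  expand = ℕ-Solver.solve-∀
  quadruple : ∀ a → 2 ℕ.* (2 ℕ.* a) ≡ a ℕ.* 4
  quadruple = ℕ-Solver.solve-∀
  integral : + (a ℕ.* (p ℕ.+ r) ℕ.+ 2 ℕ.* c ℕ.* ∣ x₂ ∣²) ≡ + (2 ℕ.* (2 ℕ.* a))
  integral = trans (sym (K₄-norm a c x₀ x₁ x₂))
    (trans (cong (+ 2 *_) norm) (trans (cong (+ 2 *_) (sym (ℤ.pos-* 2 a))) (sym (ℤ.pos-* 2 (2 ℕ.* a)))))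

K₄-bottom-cases : ∀ {a c t r} x₀ x₂ → 0 ℕ.< a → 0 ℕ.< c →
  ¬ (a ≡ 1 × a ℕ.+ c ≡ 2) → ¬ (a ≡ 2 × a ℕ.+ c ≡ 3) → ∣ x₂ ∣ ≡ t ℕ.* a →
  ∣ + 2 * x₀ - x₂ ∣² ℕ.+ r ℕ.+ 2 ℕ.* (c ℕ.* (t ℕ.* t) ℕ.* a) ≡ 4 → x₂ ≡ 0ℤ
K₄-bottom-cases {t = zero} _ _ _ _ _ _ ∣x₂∣≡0 _ = ℤ.∣i∣≡0⇒i≡0 ∣x₂∣≡0
K₄-bottom-cases {a} {c} {suc t} {r} x₀ x₂ 0<a 0<c ¬[1,2] ¬[2,3] ∣x₂∣≡ta reduced
  with small-product {t = suc t} 0<a 0<c ℕ.z<s (ℕ.*-cancelˡ-≤ 2 (ℕ.≤-trans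
      (ℕ.m≤n+m (2 ℕ.* (c ℕ.* (suc t ℕ.* suc t) ℕ.* a)) (∣ + 2 * x₀ - x₂ ∣² ℕ.+ r)) (ℕ.≤-reflexive reduced)))
... | here refl                 = contradiction (refl , refl) ¬[1,2]
... | there (here refl)         = contradiction (refl , refl) ¬[2,3]
... | there (there (here refl)) = contradiction ∣x₂∣≡ta
  (even≢±1 x₀ x₂ (∣∣²≡0⇒≡0 _ (ℕ.m+n≡0⇒m≡0 _ (ℕ.+-cancelʳ-≡ 4 _ 0 reduced))))

K₄-bottom-zero : ∀ {a c} → 0 ℕ.< a → 0 ℕ.< c → Coprime a (a ℕ.+ c) →
  ¬ (a ≡ 1 × a ℕ.+ c ≡ 2) → ¬ (a ≡ 2 × a ℕ.+ c ≡ 3) → ∀ x₀ x₁ x₂ m →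
  form (K₄ a (a ℕ.+ c)) (x₀ ∷ x₁ ∷ x₂ ∷ []) (x₀ ∷ x₁ ∷ x₂ ∷ []) ≡ + 2 * + a →
  form (K₄ a (a ℕ.+ c)) (x₀ ∷ x₁ ∷ x₂ ∷ []) (0ℤ ∷ 0ℤ ∷ 1ℤ ∷ []) ≡ + a * m → x₂ ≡ 0ℤ
K₄-bottom-zero {a} 0<a 0<c coprime ¬[1,2] ¬[2,3] x₀ x₁ x₂ m norm orthogonality =
  K₄-bottom-cases {t = quotient a∣x₂} x₀ x₂ 0<a 0<c ¬[1,2] ¬[2,3] (equality a∣x₂)
    (K₄-reduced-norm 0<a x₀ x₁ x₂ (quotient a∣x₂) norm (equality a∣x₂))
  where
  open _∣_
  a∣x₂ : a ∣ ∣ x₂ ∣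
  a∣x₂ = K₄-bottom-divisible coprime x₀ x₁ x₂ m orthogonality

K₄-axis : ∀ {a c g} → 0 ℕ.< a → 0 ℕ.< c → Coprime a (a ℕ.+ c) →
  ¬ (a ≡ 1 × a ℕ.+ c ≡ 2) → ¬ (a ≡ 2 × a ℕ.+ c ≡ 3) → IsIsometry (K₄ a (a ℕ.+ c)) g → Preserves (K₃ 0 1) g
K₄-axis {a} {c} {g@(mat₃ u₀ v₀ w₀ u₁ v₁ w₁ u₂ v₂ w₂)} 0<a 0<c coprime ¬[1,2] ¬[2,3]
        ((h@(mat₃ h₀₀ h₀₁ h₀₂ h₁₀ h₁₁ h₁₂ h₂₀ h₂₁ h₂₂) , gh≡1 , _) , isometry) =
  Equivalence.from preserves-K₃01⇔ (u₂≡0 , v₂≡0 , corner-unit {u₀} {v₀} {w₀} {u₁} {v₁} {w₁} h u₂≡0 v₂≡0 gh≡1)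
  where
  G : Mat 3
  G = K₄ a (a ℕ.+ c)
  preserves : Preserves G g
  preserves = Equivalence.to (isometry⇔preserves G g) isometry
  e₃ : Vec ℤ 3
  e₃ = 0ℤ ∷ 0ℤ ∷ 1ℤ ∷ []
  through-e₃ : ∀ i → form G (column g i) e₃ ≡ sumℤ (tabulate λ k → entry h k #2 * entry G i k)
  through-e₃ i = begin
    form G (column g i) e₃                   ≡⟨ cong (λ M → form G (column g i) (column M #2)) gh≡1 ⟨
    form G (column g i) (column (g ⊗ h) #2)  ≡⟨ form-column-⊗ G g h (column g i) #2 ⟩
    sumℤ (tabulate λ k → entry h k #2 * form G (column g i) (column g k))
      ≡⟨ cong sumℤ (tabulate-cong λ k → cong (entry h k #2 *_) (preserves i k)) ⟩
    sumℤ (tabulate λ k → entry h k #2 * entry G i k) ∎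
  row₀ : ∀ A p q r → p * (+ 2 * A) + (q * 0ℤ + (r * - A + 0ℤ)) ≡ A * (+ 2 * p - r)
  row₀ = solve-∀
  row₁ : ∀ A p q r → p * 0ℤ + (q * (+ 2 * A) + (r * - A + 0ℤ)) ≡ A * (+ 2 * q - r)
  row₁ = solve-∀
  u₂≡0 : u₂ ≡ 0ℤ
  u₂≡0 = K₄-bottom-zero 0<a 0<c coprime ¬[1,2] ¬[2,3] u₀ u₁ u₂ (+ 2 * h₀₂ - h₂₂) (preserves #0 #0)
    (trans (through-e₃ #0) (row₀ (+ a) h₀₂ h₁₂ h₂₂))
  v₂≡0 : v₂ ≡ 0ℤ
  v₂≡0 = K₄-bottom-zero 0<a 0<c coprime ¬[1,2] ¬[2,3] v₀ v₁ v₂ (+ 2 * h₁₂ - h₂₂) (preserves #1 #1)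
    (trans (through-e₃ #1) (row₁ (+ a) h₀₂ h₁₂ h₂₂))

listed⇒isometry : ∀ {G A E B F gs g} → LinearCombination G A E B F →
  All (Listed E F gs) gs → g ∈ gs → IsIsometry G g
listed⇒isometry {G} {A} {E} {B} {F} {g = g} combination listed g∈gs with All.lookup listed g∈gs
... | preservesE , preservesF , invertible = Any.satisfied invertible ,
  Equivalence.from (isometry⇔preserves G g)
    (preserves-combination {G = G} {A} {E} {B} {F} {g} combination preservesE preservesF)

combination-coprime : ∀ {G E F : Mat n} {a b} → LinearCombination G (+ a) E (+ b) F →
  Primitive G → Coprime a b
combination-coprime {E = E} {F} {a} {b} (entrywise combination) unit-scale {d} (d∣a , d∣b) =
  unit-scale d λ i j →
  ℤ.∣⇒∣ᵤ (subst (ℤ._∣_ (+ d)) (sym (combination i j))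
    (ℤ.∣m∣n⇒∣m+n (ℤ.∣m⇒∣m*n (entry E i j) (ℤ.∣ᵤ⇒∣ {i = + a} d∣a))
                 (ℤ.∣m⇒∣m*n (entry F i j) (ℤ.∣ᵤ⇒∣ {i = + b} d∣b))))

positive-⊖⇒< : ∀ m n → 0ℤ < m ⊖ n → n ℕ.< m
positive-⊖⇒< m n 0<m⊖n with n ℕ.<? m
... | yes n<m = n<m
... | no  n≮m = contradiction
  (ℤ.<-≤-trans (subst (0ℤ <_) (ℤ.⊖-≤ (ℕ.≮⇒≥ n≮m)) 0<m⊖n) ℤ.neg-≤-pos) (ℤ.<-irrefl refl)

K₄-positive⇒< : ∀ {a b} → PositiveDefinite (K₄ a b) → a ℕ.< b
K₄-positive⇒< {a} {b} positive =
  ℕ.*-cancelʳ-< 4 a b (positive-⊖⇒< (b ℕ.* 4) (a ℕ.* 4) (subst (0ℤ <_) value (positive v (λ ()))))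
  where
  v : Vec ℤ 3
  v = + 1 ∷ + 1 ∷ + 2 ∷ []
  value : qform (K₄ a b) v ≡ (b ℕ.* 4) ⊖ (a ℕ.* 4)
  value = begin
    qform (K₄ a b) v                                    ≡⟨ qform≡form (K₄ a b) v ⟩
    form (K₄ a b) v v                                   ≡⟨ form-linear (K₄-linear a b) v v ⟩
    + a * -[1+ 3 ] + + b * + 4                          ≡⟨ cong₂ _+_ (ℤ.-◃n≡-n (a ℕ.* 4)) (ℤ.+◃n≡+n (b ℕ.* 4)) ⟩
    - + (a ℕ.* 4) + + (b ℕ.* 4)                         ≡⟨ ℤ.-m+n≡n⊖m (a ℕ.* 4) (b ℕ.* 4) ⟩
    (b ℕ.* 4) ⊖ (a ℕ.* 4)                               ∎

positive-difference : ∀ {a b} → a ℕ.< b → ∃ λ c → 0 ℕ.< c × a ℕ.+ c ≡ b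
positive-difference {a} a<b with ℕ.m≤n⇒∃[o]m+o≡n a<b
... | o , a+1+o≡b = suc o , ℕ.z<s , trans (ℕ.+-suc a o) a+1+o≡b

K₃-isometry⇔ : ∀ {a b} .{{_ : ℕ.NonZero a}} .{{_ : ℕ.NonZero b}} → a ≢ b →
  ∀ g → IsIsometry (K₃ a b) g ⇔ g ∈ K₃-isometries
K₃-isometry⇔ {a} {b} a≢b g = mk⇔ forward (listed⇒isometry (K₃-linear a b) K₃-listed)
  where
  axis : IsIsometry (K₃ a b) g → Preserves (K₃ 0 1) g
  axis isometry = by-comparison (ℕ.<-cmp a b)
    where
    by-comparison : Tri (a ℕ.< b) (a ≡ b) (b ℕ.< a) → Preserves (K₃ 0 1) g
    by-comparison (tri< a<b _ _) = K₃-axis-< {g = g} a<b isometry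
    by-comparison (tri≈ _ a≡b _) = contradiction a≡b a≢b
    by-comparison (tri> _ _ b<a) = K₃-axis-> {g = g} b<a isometry
  forward : IsIsometry (K₃ a b) g → g ∈ K₃-isometries
  forward isometry = K₃-parts⇒∈ g (axis isometry)
    (preserves-cancel {g = g} (K₃-linear a b)
      (Equivalence.to (isometry⇔preserves (K₃ a b) g) (proj₂ isometry)) (axis isometry))

K₄-isometry⇔ : ∀ {a c} → 0 ℕ.< a → 0 ℕ.< c → Coprime a (a ℕ.+ c) →
  ¬ (a ≡ 1 × a ℕ.+ c ≡ 2) → ¬ (a ≡ 2 × a ℕ.+ c ≡ 3) →
  ∀ g → IsIsometry (K₄ a (a ℕ.+ c)) g ⇔ g ∈ K₄-isometries
K₄-isometry⇔ {a} {c} 0<a 0<c coprime ¬[1,2] ¬[2,3] g =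
  mk⇔ forward (listed⇒isometry (K₄-linear a (a ℕ.+ c)) K₄-listed)
  where
  instance
    a≢0 : ℕ.NonZero a
    a≢0 = ℕ.>-nonZero 0<a
  forward : IsIsometry (K₄ a (a ℕ.+ c)) g → g ∈ K₄-isometries
  forward isometry = K₄-parts⇒∈ g axis
    (preserves-cancel {g = g} (K₄-linear a (a ℕ.+ c))
      (Equivalence.to (isometry⇔preserves (K₄ a (a ℕ.+ c)) g) (proj₂ isometry)) axis)
    where
    axis : Preserves (K₃ 0 1) g
    axis = K₄-axis {g = g} 0<a 0<c coprime ¬[1,2] ¬[2,3] isometry

K₃-order : ∀ {a b} → a > 0 → b > 0 → Primitive (K₃ a b) → ¬ (a ≡ 1 × b ≡ 1) →
  IsometryGroupOrder (K₃ a b) 16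
K₃-order {a} {b} a>0 b>0 unit-scale ¬[1,1] =
  K₃-isometries , refl , K₃-unique , K₃-isometry⇔ {{ℕ.>-nonZero a>0}} {{ℕ.>-nonZero b>0}} a≢b
  where
  a≢b : a ≢ b
  a≢b refl = ¬[1,1] (a≡1 , a≡1)
    where
    a≡1 : a ≡ 1
    a≡1 = combination-coprime (K₃-linear a a) unit-scale (∣-refl , ∣-refl)

K₄-order : ∀ {a b} → a > 0 → Primitive (K₄ a b) → PositiveDefinite (K₄ a b) →
  ¬ (a ≡ 1 × b ≡ 2) → ¬ (a ≡ 2 × b ≡ 3) → IsometryGroupOrder (K₄ a b) 16
K₄-order {a} a>0 unit-scale positive with positive-difference (K₄-positive⇒< positive)
... | c , c>0 , refl = λ ¬[1,2] ¬[2,3] → K₄-isometries , refl , K₄-unique ,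
  K₄-isometry⇔ a>0 c>0 (combination-coprime (K₄-linear a (a ℕ.+ c)) unit-scale) ¬[1,2] ¬[2,3]

lemma4p3 : (a b : ℕ) → a > 0 → b > 0 →
    ((Primitive (K₃ a b) → PositiveDefinite (K₃ a b) →
       ¬ ((a ≡ 1) × (b ≡ 1)) → IsometryGroupOrder (K₃ a b) 16)
    × (Primitive (K₄ a b) → PositiveDefinite (K₄ a b) →
       ¬ ((a ≡ 1) × (b ≡ 2)) → ¬ ((a ≡ 2) × (b ≡ 3)) → IsometryGroupOrder (K₄ a b) 16))
lemma4p3 a b a>0 b>0 =
    (λ unit-scale _ → K₃-order a>0 b>0 unit-scale)
  , (λ unit-scale → K₄-order a>0 unit-scale)
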